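{- Let $d(x)\in\mathbb{Z}[x]$ be monic, quartic and square-free. Suppose $d(x)$ is Pellian over $\mathbb{Q}[x]$, and that some solution $f(x),g(x)\in\mathbb{Q}[x]$ with $g\neq0$ of $f(x)^2-d(x)g(x)^2=1$ has $f(x)$ with integral leading coefficient. Then every nontrivial solution $f(x),g(x)\in\mathbb{Q}[x]$ ($g\ne 0$) of $f(x)^2-d(x)g(x)^2=1$ has $f(x)$ (and $g(x)$) with integral leading coefficient.
   Context: A non-square $d(x)\in\mathbb{Q}[x]$ is Pellian over $\mathbb{Q}[x]$ if there exist $f(x),g(x)\in\mathbb{Q}[x]$ with $g\neq 0$ and $f(x)^2-d(x)g(x)^2=1$. For monic $d$, in any such solution the leading coefficients of $f$ and $g$ agree up to sign. -}

module Defs where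

open import Data.Nat using (ℕ; zero; suc; _+_)
open import Data.Integer using (ℤ)
open import Data.Rational using (ℚ; 0ℚ; 1ℚ; _/_; -_) renaming (_+_ to _+ℚ_; _*_ to _*ℚ_)
open import Data.Rational.Properties using (_≟_)
open import Data.List using (List; []; _∷_; map)
open import Data.Product using (∃; Σ; _×_; _,_)
open import Data.Sum using (_⊎_)
open import Relation.Nullary using (¬_; yes; no)
open import Relation.Binary.PropositionalEquality using (_≡_)

-- Polynomials over ℚ as coefficient lists, lowest degree first.
-- Trailing zeros are allowed; polynomials are compared coefficientwise.
Poly : Set
Poly = List ℚ

coeff : Poly → ℕ → ℚ
coeff []       _       = 0ℚ
coeff (a ∷ p)  zero    = a
coeff (a ∷ p)  (suc n) = coeff p n

infixl 6 _⊕_ _⊖_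
infixl 7 _⊛_
infix 4 _≈ₚ_

_⊕_ : Poly → Poly → Poly
[]      ⊕ q       = q
(a ∷ p) ⊕ []      = a ∷ p
(a ∷ p) ⊕ (b ∷ q) = (a +ℚ b) ∷ (p ⊕ q)

negₚ : Poly → Poly
negₚ = map -_

_⊖_ : Poly → Poly → Poly
p ⊖ q = p ⊕ negₚ q

_⊛_ : Poly → Poly → Poly
[]      ⊛ q = []
(a ∷ p) ⊛ q = map (a *ℚ_) q ⊕ (0ℚ ∷ (p ⊛ q))

oneₚ : Poly
oneₚ = 1ℚ ∷ []

_≈ₚ_ : Poly → Poly → Set
p ≈ₚ q = ∀ n → coeff p n ≡ coeff q n

IsZeroPoly : Poly → Set
IsZeroPoly p = ∀ n → coeff p n ≡ 0ℚ

-- leading coefficient (0 for the zero polynomial)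
lc : Poly → ℚ
lc []      = 0ℚ
lc (a ∷ p) with lc p ≟ 0ℚ
... | yes _ = a
... | no  _ = lc p

IsIntegerℚ : ℚ → Set
IsIntegerℚ q = ∃ λ (k : ℤ) → q ≡ k / 1

IntPoly : Poly → Set
IntPoly p = ∀ n → IsIntegerℚ (coeff p n)

MonicQuartic : Poly → Set
MonicQuartic d = (coeff d 4 ≡ 1ℚ) × (∀ n → coeff d (5 + n) ≡ 0ℚ)

IsUnitℤx : Poly → Set
IsUnitℤx h = (h ≈ₚ (1ℚ ∷ [])) ⊎ (h ≈ₚ (- 1ℚ ∷ []))

SquareFreeℤx : Poly → Set
SquareFreeℤx d = ∀ h q → IntPoly h → IntPoly q → d ≈ₚ h ⊛ h ⊛ q → IsUnitℤx h

PellSolution : Poly → Poly → Poly → Set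
PellSolution d f g = (¬ IsZeroPoly g) × (f ⊛ f ⊖ d ⊛ g ⊛ g ≈ₚ oneₚ)

IsSquarePoly : Poly → Set
IsSquarePoly d = ∃ λ s → d ≈ₚ s ⊛ s

Pellian : Poly → Set
Pellian d = (¬ IsSquarePoly d) × (∃ λ f → ∃ λ g → PellSolution d f g)

{-# OPTIONS --safe #-}
module Submission where

-- Normalise a solution (f, g) of f² − d g² = 1 so that f and g have the same leading coefficient a;
-- comparing leading terms in f² = 1 + d g² gives deg f = deg g + m, where deg d = 2m. The product
-- (f + g√d)(f′ + g′√d) of two normalised solutions is again one, the degrees of f adding up and the
-- leading coefficient being 2aa′; so the n-th power of a solution has leading coefficient (2a)ⁿ/2.
-- Two normalised solutions whose f have equal degree have leading coefficients equal up to sign: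
-- dividing one by the other gives a solution (F, G), and if G ≠ 0 multiplying it back would give f
-- too large a degree, while if G = 0 then F = ±1. Raising a solution with leading coefficient a and
-- the given one with leading coefficient k ∈ ℤ to powers of a common degree yields (2a)ⁱ = ±(2k)ʲ,
-- so 2a is an integer with an even power, hence even, and a ∈ ℤ.

open import Defs

open import Data.Empty using (⊥-elim)
open import Data.Unit using (tt)
open import Data.Product using (∃; _×_; _,_; proj₁; proj₂)
open import Data.Sum as Sum using (_⊎_; inj₁; inj₂)
open import Data.Maybe using (Maybe; just; nothing)
open import Data.List using ([]; _∷_; map)
open import Data.Nat as ℕ using (ℕ; zero; suc; _+_; _*_; _<_; s≤s; z≤n)
import Data.Nat.Properties as ℕ
import Data.Nat.Divisibility as ℕ
open import Data.Nat.Coprimality as Coprimality using (Coprime)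
open import Data.Nat.Primality using (Prime; prime?; euclidsLemma)
open import Data.Nat.Tactic.RingSolver using (solve-∀)
open import Data.Integer as ℤ using (ℤ; +_; ∣_∣)
import Data.Integer.Properties as ℤ
import Data.Integer.Divisibility.Signed as ℤ
import Data.Integer.Solver
open import Data.Rational
  using (ℚ; mkℚ; 0ℚ; 1ℚ; -_; 1/_; _/_; ↥_; ≢-nonZero; toℚᵘ; +-*-rawSemiring; +-*-rawRing)
  renaming (_+_ to _+ℚ_; _*_ to _*ℚ_)
import Data.Rational.Properties as ℚ
open import Data.Rational.Solver using (module +-*-Solver)
open import Data.Rational.Unnormalised.Base as ℚᵘ using (mkℚᵘ)
import Data.Rational.Unnormalised.Properties as ℚᵘ
open import Relation.Nullary using (¬_; yes; no)
open import Relation.Nullary.Decidable using (toWitness)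
open import Relation.Binary.Bundles using (Setoid)
open import Relation.Binary.Definitions using (tri<; tri≈; tri>)
open import Relation.Binary.PropositionalEquality
import Relation.Binary.Reasoning.Setoid
open import Algebra.Bundles using (CommutativeSemigroup; CommutativeRing)
open import Algebra.Definitions.RawSemiring +-*-rawSemiring using (_^_)
import Algebra.Properties.CommutativeSemigroup
open import Algebra.Properties.Group ℚ.+-0-group using (x∙y⁻¹≈ε⇒x≈y; inverseˡ-unique; ⁻¹-involutive)
open import Algebra.Properties.Ring ℚ.+-*-ring using (-1*x≈-x)

x+x≡y+y⇒x≡y : ∀ x y → x + x ≡ y + y → x ≡ y
x+x≡y+y⇒x≡y x y e with ℕ.<-cmp x y
... | tri< x<y _ _ = ⊥-elim (ℕ.<-irrefl e (ℕ.+-mono-< x<y x<y))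
... | tri≈ _ x≡y _ = x≡y
... | tri> _ _ y<x = ⊥-elim (ℕ.<-irrefl (sym e) (ℕ.+-mono-< y<x y<x))

module _ {c : ℚ} (c≢0 : c ≢ 0ℚ) where
  private instance _ = ≢-nonZero c≢0

  *-cancelˡ-≡ : ∀ {a b} → c *ℚ a ≡ c *ℚ b → a ≡ b
  *-cancelˡ-≡ {a} {b} e = begin
    a                  ≡⟨ sym (1/c*[c*x]≡x a) ⟩
    1/ c *ℚ (c *ℚ a)   ≡⟨ cong (1/ c *ℚ_) e ⟩
    1/ c *ℚ (c *ℚ b)   ≡⟨ 1/c*[c*x]≡x b ⟩
    b                  ∎
    where
    open ≡-Reasoning
    1/c*[c*x]≡x : ∀ x → 1/ c *ℚ (c *ℚ x) ≡ x
    1/c*[c*x]≡x x = trans (sym (ℚ.*-assoc (1/ c) c x)) (trans (cong (_*ℚ x) (ℚ.*-inverseˡ c)) (ℚ.*-identityˡ x))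

  c*x≡0⇒x≡0 : ∀ {x} → c *ℚ x ≡ 0ℚ → x ≡ 0ℚ
  c*x≡0⇒x≡0 e = *-cancelˡ-≡ (trans e (sym (ℚ.*-zeroʳ c)))

x*y≡0⇒x≡0∨y≡0 : ∀ x {y} → x *ℚ y ≡ 0ℚ → x ≡ 0ℚ ⊎ y ≡ 0ℚ
x*y≡0⇒x≡0∨y≡0 x e with x ℚ.≟ 0ℚ
... | yes x≡0 = inj₁ x≡0
... | no  x≢0 = inj₂ (c*x≡0⇒x≡0 x≢0 e)

x≢0∧y≢0⇒x*y≢0 : ∀ {x y} → x ≢ 0ℚ → y ≢ 0ℚ → x *ℚ y ≢ 0ℚ
x≢0∧y≢0⇒x*y≢0 {x} x≢0 y≢0 xy≡0 with x*y≡0⇒x≡0∨y≡0 x xy≡0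
... | inj₁ x≡0 = x≢0 x≡0
... | inj₂ y≡0 = y≢0 y≡0

x*x≡y*y⇒x≡y∨x≡-y : ∀ x y → x *ℚ x ≡ y *ℚ y → x ≡ y ⊎ x ≡ - y
x*x≡y*y⇒x≡y∨x≡-y x y e = Sum.map (x∙y⁻¹≈ε⇒x≈y x y) (inverseˡ-unique x y)
  (x*y≡0⇒x≡0∨y≡0 (x +ℚ - y) [x-y][x+y]≡0)
  where
  open +-*-Solver
  open ≡-Reasoning
  [x-y][x+y]≡0 : (x +ℚ - y) *ℚ (x +ℚ y) ≡ 0ℚ
  [x-y][x+y]≡0 = begin
    (x +ℚ - y) *ℚ (x +ℚ y) ≡⟨ solve 2 (λ x y → (x :- y) :* (x :+ y) := x :* x :- y :* y) refl x y ⟩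
    x *ℚ x +ℚ - (y *ℚ y)   ≡⟨ cong (λ z → z +ℚ - (y *ℚ y)) e ⟩
    y *ℚ y +ℚ - (y *ℚ y)   ≡⟨ ℚ.+-inverseʳ (y *ℚ y) ⟩
    0ℚ                     ∎

-- Integrality in ℚ

fromℤ : ℤ → ℚ
fromℤ i = i / 1

module _ where
  open ℚᵘ.≃-Reasoning

  toℚᵘ-fromℤ : ∀ i → toℚᵘ (fromℤ i) ℚᵘ.≃ mkℚᵘ i 0
  toℚᵘ-fromℤ i = ℚ.toℚᵘ-fromℚᵘ (mkℚᵘ i 0)

  fromℤ-* : ∀ i j → fromℤ (i ℤ.* j) ≡ fromℤ i *ℚ fromℤ j
  fromℤ-* i j = ℚ.toℚᵘ-injective (begin
    toℚᵘ (fromℤ (i ℤ.* j))                ≈⟨ toℚᵘ-fromℤ (i ℤ.* j) ⟩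
    mkℚᵘ i 0 ℚᵘ.* mkℚᵘ j 0                ≈⟨ ℚᵘ.*-cong (toℚᵘ-fromℤ i) (toℚᵘ-fromℤ j) ⟨
    toℚᵘ (fromℤ i) ℚᵘ.* toℚᵘ (fromℤ j)    ≈⟨ ℚ.toℚᵘ-homo-* (fromℤ i) (fromℤ j) ⟨
    toℚᵘ (fromℤ i *ℚ fromℤ j)             ∎)

  fromℤ-neg : ∀ i → fromℤ (ℤ.- i) ≡ - fromℤ i
  fromℤ-neg i = ℚ.toℚᵘ-injective (begin
    toℚᵘ (fromℤ (ℤ.- i))    ≈⟨ toℚᵘ-fromℤ (ℤ.- i) ⟩
    ℚᵘ.- mkℚᵘ i 0           ≈⟨ ℚᵘ.-‿cong (toℚᵘ-fromℤ i) ⟨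
    ℚᵘ.- toℚᵘ (fromℤ i)     ≈⟨ ℚ.toℚᵘ-homo‿- (fromℤ i) ⟨
    toℚᵘ (- fromℤ i)        ∎)

  fromℤ-injective : ∀ {i j} → fromℤ i ≡ fromℤ j → i ≡ j
  fromℤ-injective {i} {j} e =
    trans (sym (ℤ.*-identityʳ i)) (trans (ℚᵘ.drop-*≡* i≃j) (ℤ.*-identityʳ j))
    where
    i≃j : mkℚᵘ i 0 ℚᵘ.≃ mkℚᵘ j 0
    i≃j = begin
      mkℚᵘ i 0          ≈⟨ toℚᵘ-fromℤ i ⟨
      toℚᵘ (fromℤ i)    ≡⟨ cong toℚᵘ e ⟩
      toℚᵘ (fromℤ j)    ≈⟨ toℚᵘ-fromℤ j ⟩
      mkℚᵘ j 0          ∎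

fromℤ-^ : ∀ i n → fromℤ (i ℤ.^ n) ≡ fromℤ i ^ n
fromℤ-^ i zero    = refl
fromℤ-^ i (suc n) = trans (fromℤ-* i (i ℤ.^ n)) (cong (fromℤ i *ℚ_) (fromℤ-^ i n))

IsIntegerℚ-neg : ∀ {x} → IsIntegerℚ x → IsIntegerℚ (- x)
IsIntegerℚ-neg (k , refl) = ℤ.- k , sym (fromℤ-neg k)

2ℚ : ℚ
2ℚ = fromℤ (+ 2)

x≢0⇒x+x≢0 : ∀ {x} → x ≢ 0ℚ → x +ℚ x ≢ 0ℚ
x≢0⇒x+x≢0 {x} x≢0 x+x≡0 = x≢0 (c*x≡0⇒x≡0 {c = 2ℚ} (λ ()) (trans 2x≡x+x x+x≡0))
  where
  open +-*-Solver
  2x≡x+x : 2ℚ *ℚ x ≡ x +ℚ x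
  2x≡x+x = solve 1 (λ x → con 2ℚ :* x := x :+ x) refl x

2[xy+xy]≡2x*2y : ∀ x y → 2ℚ *ℚ (x *ℚ y +ℚ x *ℚ y) ≡ (2ℚ *ℚ x) *ℚ (2ℚ *ℚ y)
2[xy+xy]≡2x*2y = solve 2 (λ x y → con 2ℚ :* (x :* y :+ x :* y) := (con 2ℚ :* x) :* (con 2ℚ :* y)) refl
  where open +-*-Solver

∣i^n∣≡∣i∣^n : ∀ i n → ∣ i ℤ.^ n ∣ ≡ ∣ i ∣ ℕ.^ n
∣i^n∣≡∣i∣^n i zero    = refl
∣i^n∣≡∣i∣^n i (suc n) = trans (ℤ.abs-* i (i ℤ.^ n)) (cong (∣ i ∣ *_) (∣i^n∣≡∣i∣^n i n))

coprime-∣^⇒∣1 : ∀ {a b} n → Coprime a b → a ℕ.∣ b ℕ.^ n → a ℕ.∣ 1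
coprime-∣^⇒∣1 zero    a⊥b a∣1       = a∣1
coprime-∣^⇒∣1 (suc n) a⊥b a∣b*b^n = coprime-∣^⇒∣1 n a⊥b (Coprimality.coprime-divisor a⊥b a∣b*b^n)

module _ where
  open import Algebra.Definitions.RawSemiring ℚᵘ.+-*-rawSemiring using () renaming (_^_ to _^ᵘ_)

  toℚᵘ-^ : ∀ x n → toℚᵘ (x ^ n) ℚᵘ.≃ toℚᵘ x ^ᵘ n
  toℚᵘ-^ x zero    = ℚᵘ.≃-refl
  toℚᵘ-^ x (suc n) = ℚᵘ.≃-trans (ℚ.toℚᵘ-homo-* x (x ^ n)) (ℚᵘ.*-cong (ℚᵘ.≃-refl {toℚᵘ x}) (toℚᵘ-^ x n))

  ↥-* : ∀ p q → ℚᵘ.↥ (p ℚᵘ.* q) ≡ ℚᵘ.↥ p ℤ.* ℚᵘ.↥ q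
  ↥-* (mkℚᵘ _ _) (mkℚᵘ _ _) = refl

  ↧ₙ-* : ∀ p q → ℚᵘ.↧ₙ (p ℚᵘ.* q) ≡ ℚᵘ.↧ₙ p * ℚᵘ.↧ₙ q
  ↧ₙ-* (mkℚᵘ _ _) (mkℚᵘ _ _) = refl

  ↥-^ : ∀ p n → ℚᵘ.↥ (p ^ᵘ n) ≡ ℚᵘ.↥ p ℤ.^ n
  ↥-^ p zero    = refl
  ↥-^ p (suc n) = trans (↥-* p (p ^ᵘ n)) (cong (ℚᵘ.↥ p ℤ.*_) (↥-^ p n))

  ↧ₙ-^ : ∀ p n → ℚᵘ.↧ₙ (p ^ᵘ n) ≡ ℚᵘ.↧ₙ p ℕ.^ n
  ↧ₙ-^ p zero    = refl
  ↧ₙ-^ p (suc n) = trans (↧ₙ-* p (p ^ᵘ n)) (cong (ℚᵘ.↧ₙ p *_) (↧ₙ-^ p n))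

  -- rational root test: the reduced denominator of x divides a power of its coprime numerator
  IsIntegerℚ-^⇒IsIntegerℚ : ∀ x n → IsIntegerℚ (x ^ suc n) → IsIntegerℚ x
  IsIntegerℚ-^⇒IsIntegerℚ x@(mkℚ a q-1 a⊥q) n (z , xᵏ≡z) = ↥ x , integral (ℕ.suc-injective q≡1)
    where
    q = suc q-1
    k = suc n
    [a/q]ᵏ≃z : mkℚᵘ a q-1 ^ᵘ k ℚᵘ.≃ mkℚᵘ z 0
    [a/q]ᵏ≃z = ℚᵘ.≃-trans (ℚᵘ.≃-sym (toℚᵘ-^ x k)) (ℚᵘ.≃-trans (ℚᵘ.≃-reflexive (cong toℚᵘ xᵏ≡z)) (toℚᵘ-fromℤ z))
    ∣a∣ᵏ≡∣z∣qᵏ : ∣ a ∣ ℕ.^ k ≡ ∣ z ∣ * q ℕ.^ k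
    ∣a∣ᵏ≡∣z∣qᵏ = begin
      ∣ a ∣ ℕ.^ k                                    ≡⟨ ∣i^n∣≡∣i∣^n a k ⟨
      ∣ a ℤ.^ k ∣                                    ≡⟨ cong ∣_∣ (ℤ.*-identityʳ (a ℤ.^ k)) ⟨
      ∣ a ℤ.^ k ℤ.* + 1 ∣                            ≡⟨ cong (λ t → ∣ t ℤ.* + 1 ∣) (↥-^ (mkℚᵘ a q-1) k) ⟨
      ∣ ℚᵘ.↥ (mkℚᵘ a q-1 ^ᵘ k) ℤ.* + 1 ∣             ≡⟨ cong ∣_∣ (ℚᵘ.drop-*≡* [a/q]ᵏ≃z) ⟩
      ∣ z ℤ.* + ℚᵘ.↧ₙ (mkℚᵘ a q-1 ^ᵘ k) ∣            ≡⟨ ℤ.abs-* z _ ⟩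
      ∣ z ∣ * ℚᵘ.↧ₙ (mkℚᵘ a q-1 ^ᵘ k)                ≡⟨ cong (∣ z ∣ *_) (↧ₙ-^ (mkℚᵘ a q-1) k) ⟩
      ∣ z ∣ * q ℕ.^ k                                ∎
      where open ≡-Reasoning
    q∣∣a∣ᵏ : q ℕ.∣ ∣ a ∣ ℕ.^ k
    q∣∣a∣ᵏ = ℕ.∣-trans (ℕ.m∣m*n (q ℕ.^ n)) (ℕ.divides ∣ z ∣ ∣a∣ᵏ≡∣z∣qᵏ)
    q≡1 : q ≡ 1
    q≡1 = ℕ.∣1⇒≡1 (coprime-∣^⇒∣1 k (Coprimality.sym (Coprimality.recompute a⊥q)) q∣∣a∣ᵏ)
    integral : q-1 ≡ 0 → x ≡ fromℤ (↥ x)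
    integral refl = sym (ℚ.↥p/↧p≡p x)

prime∣m^[1+n]⇒prime∣m : ∀ {p} m n → Prime p → p ℕ.∣ m ℕ.^ suc n → p ℕ.∣ m
prime∣m^[1+n]⇒prime∣m {p} m zero    _  p∣m^1 = subst (p ℕ.∣_) (ℕ.*-identityʳ m) p∣m^1
prime∣m^[1+n]⇒prime∣m     m (suc n) pp p∣m*m^n =
  Sum.[ (λ p∣m → p∣m) , prime∣m^[1+n]⇒prime∣m m n pp ] (euclidsLemma m (m ℕ.^ suc n) pp p∣m*m^n)

prime∣^⇒prime∣ : ∀ {p} x n w → Prime p → x ^ suc n ≡ fromℤ (w ℤ.* + p) → ∃ λ y → x ≡ fromℤ (y ℤ.* + p)
prime∣^⇒prime∣ {p} x n w pp xᵏ≡wp with IsIntegerℚ-^⇒IsIntegerℚ x n (w ℤ.* + p , xᵏ≡wp)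
... | c , x≡c = ℤ.quotient p∣c , trans x≡c (cong fromℤ (ℤ._∣_.equality p∣c))
  where
  cᵏ≡wp : c ℤ.^ suc n ≡ w ℤ.* + p
  cᵏ≡wp = fromℤ-injective (trans (fromℤ-^ c (suc n)) (trans (cong (_^ suc n) (sym x≡c)) xᵏ≡wp))
  p∣∣c∣ᵏ : p ℕ.∣ ∣ c ∣ ℕ.^ suc n
  p∣∣c∣ᵏ = subst (p ℕ.∣_) (∣i^n∣≡∣i∣^n c (suc n)) (ℤ.∣⇒∣ᵤ (ℤ.divides w cᵏ≡wp))
  p∣c : + p ℤ.∣ c
  p∣c = ℤ.∣ᵤ⇒∣ (prime∣m^[1+n]⇒prime∣m ∣ c ∣ n pp p∣∣c∣ᵏ)

2-prime : Prime 2
2-prime = toWitness {a? = prime? 2} tt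

[2a]ⁱ≡±[2k]ʲ⇒IsIntegerℚ : ∀ a k i j →
  (2ℚ *ℚ a) ^ suc i ≡ (2ℚ *ℚ fromℤ k) ^ suc j ⊎ (2ℚ *ℚ a) ^ suc i ≡ - ((2ℚ *ℚ fromℤ k) ^ suc j) →
  IsIntegerℚ a
[2a]ⁱ≡±[2k]ʲ⇒IsIntegerℚ a k i j ±e =
  let v , [2a]ⁱ⁺¹≡2v = [2a]ⁱ⁺¹≡2multiple
      y , 2a≡2y      = prime∣^⇒prime∣ (2ℚ *ℚ a) i v 2-prime [2a]ⁱ⁺¹≡2v
  in  y , *-cancelˡ-≡ {c = 2ℚ} (λ ()) (trans 2a≡2y (trans (fromℤ-* y (+ 2)) (ℚ.*-comm (fromℤ y) 2ℚ)))
  where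
  open ≡-Reasoning
  w : ℤ
  w = k ℤ.* (+ 2 ℤ.* k) ℤ.^ j
  [2k]ʲ⁺¹≡2w : (2ℚ *ℚ fromℤ k) ^ suc j ≡ fromℤ (w ℤ.* + 2)
  [2k]ʲ⁺¹≡2w = begin
    (2ℚ *ℚ fromℤ k) ^ suc j       ≡⟨ cong (_^ suc j) (fromℤ-* (+ 2) k) ⟨
    fromℤ (+ 2 ℤ.* k) ^ suc j     ≡⟨ fromℤ-^ (+ 2 ℤ.* k) (suc j) ⟨
    fromℤ ((+ 2 ℤ.* k) ℤ.^ suc j) ≡⟨ cong fromℤ (solve 2 (λ k t → (con (+ 2) :* k) :* t := (k :* t) :* con (+ 2)) refl k ((+ 2 ℤ.* k) ℤ.^ j)) ⟩
    fromℤ (w ℤ.* + 2)             ∎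
    where open Data.Integer.Solver.+-*-Solver
  [2a]ⁱ⁺¹≡-2w : (2ℚ *ℚ a) ^ suc i ≡ - ((2ℚ *ℚ fromℤ k) ^ suc j) → (2ℚ *ℚ a) ^ suc i ≡ fromℤ (ℤ.- w ℤ.* + 2)
  [2a]ⁱ⁺¹≡-2w e = begin
    (2ℚ *ℚ a) ^ suc i             ≡⟨ e ⟩
    - ((2ℚ *ℚ fromℤ k) ^ suc j)   ≡⟨ cong -_ [2k]ʲ⁺¹≡2w ⟩
    - fromℤ (w ℤ.* + 2)           ≡⟨ fromℤ-neg (w ℤ.* + 2) ⟨
    fromℤ (ℤ.- (w ℤ.* + 2))       ≡⟨ cong fromℤ (ℤ.neg-distribˡ-* w (+ 2)) ⟩
    fromℤ (ℤ.- w ℤ.* + 2)         ∎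
  [2a]ⁱ⁺¹≡2multiple : ∃ λ v → (2ℚ *ℚ a) ^ suc i ≡ fromℤ (v ℤ.* + 2)
  [2a]ⁱ⁺¹≡2multiple = Sum.[ (λ e → w , trans e [2k]ʲ⁺¹≡2w) , (λ e → ℤ.- w , [2a]ⁱ⁺¹≡-2w e) ]′ ±e

-- The polynomial ring ℚ[x]

infixr 7 _·_

_·_ : ℚ → Poly → Poly
a · p = map (a *ℚ_) p

shift : Poly → Poly
shift p = 0ℚ ∷ p

coeff-⊕ : ∀ p q n → coeff (p ⊕ q) n ≡ coeff p n +ℚ coeff q n
coeff-⊕ []      q       n       = sym (ℚ.+-identityˡ _)
coeff-⊕ (a ∷ p) []      n       = sym (ℚ.+-identityʳ _)
coeff-⊕ (a ∷ p) (b ∷ q) zero    = refl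
coeff-⊕ (a ∷ p) (b ∷ q) (suc n) = coeff-⊕ p q n

coeff-· : ∀ a p n → coeff (a · p) n ≡ a *ℚ coeff p n
coeff-· a []      n       = sym (ℚ.*-zeroʳ a)
coeff-· a (b ∷ p) zero    = refl
coeff-· a (b ∷ p) (suc n) = coeff-· a p n

coeff-neg : ∀ p n → coeff (negₚ p) n ≡ - coeff p n
coeff-neg []      n       = refl
coeff-neg (b ∷ p) zero    = refl
coeff-neg (b ∷ p) (suc n) = coeff-neg p n

infix 4 _≈_

-- A record rather than the function type _≈ₚ_, so that p and q can be inferred from a proof of p ≈ q.
record _≈_ (p q : Poly) : Set where
  constructor ≈ₚ⇒≈
  field ≈⇒≈ₚ : p ≈ₚ q
open _≈_

≈-refl : ∀ {p} → p ≈ p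
≈-refl = ≈ₚ⇒≈ λ _ → refl

≈-sym : ∀ {p q} → p ≈ q → q ≈ p
≈-sym (≈ₚ⇒≈ e) = ≈ₚ⇒≈ λ n → sym (e n)

≈-trans : ∀ {p q r} → p ≈ q → q ≈ r → p ≈ r
≈-trans (≈ₚ⇒≈ e) (≈ₚ⇒≈ e′) = ≈ₚ⇒≈ λ n → trans (e n) (e′ n)

≈-setoid : Setoid _ _
≈-setoid = record { Carrier = Poly ; _≈_ = _≈_ ; isEquivalence = record { refl = ≈-refl ; sym = ≈-sym ; trans = ≈-trans } }

∷-cong : ∀ {a b p q} → a ≡ b → p ≈ q → a ∷ p ≈ b ∷ q
∷-cong a≡b (≈ₚ⇒≈ e) = ≈ₚ⇒≈ λ { zero → a≡b ; (suc n) → e n }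

⊕-cong : ∀ {p p′ q q′} → p ≈ p′ → q ≈ q′ → p ⊕ q ≈ p′ ⊕ q′
⊕-cong {p} {p′} {q} {q′} (≈ₚ⇒≈ e) (≈ₚ⇒≈ e′) = ≈ₚ⇒≈ λ n →
  trans (coeff-⊕ p q n) (trans (cong₂ _+ℚ_ (e n) (e′ n)) (sym (coeff-⊕ p′ q′ n)))

neg-cong : ∀ {p q} → p ≈ q → negₚ p ≈ negₚ q
neg-cong {p} {q} (≈ₚ⇒≈ e) = ≈ₚ⇒≈ λ n → trans (coeff-neg p n) (trans (cong -_ (e n)) (sym (coeff-neg q n)))

·-congʳ : ∀ a {p q} → p ≈ q → a · p ≈ a · q
·-congʳ a {p} {q} (≈ₚ⇒≈ e) = ≈ₚ⇒≈ λ n → trans (coeff-· a p n) (trans (cong (a *ℚ_) (e n)) (sym (coeff-· a q n)))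

⊕-comm : ∀ p q → p ⊕ q ≈ q ⊕ p
⊕-comm p q = ≈ₚ⇒≈ λ n → trans (coeff-⊕ p q n) (trans (ℚ.+-comm (coeff p n) (coeff q n)) (sym (coeff-⊕ q p n)))

⊕-assoc : ∀ p q r → (p ⊕ q) ⊕ r ≈ p ⊕ (q ⊕ r)
⊕-assoc p q r = ≈ₚ⇒≈ λ n → begin
  coeff ((p ⊕ q) ⊕ r) n                      ≡⟨ coeff-⊕ (p ⊕ q) r n ⟩
  coeff (p ⊕ q) n +ℚ coeff r n               ≡⟨ cong (_+ℚ coeff r n) (coeff-⊕ p q n) ⟩
  (coeff p n +ℚ coeff q n) +ℚ coeff r n      ≡⟨ ℚ.+-assoc (coeff p n) (coeff q n) (coeff r n) ⟩
  coeff p n +ℚ (coeff q n +ℚ coeff r n)      ≡⟨ cong (coeff p n +ℚ_) (coeff-⊕ q r n) ⟨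
  coeff p n +ℚ coeff (q ⊕ r) n               ≡⟨ coeff-⊕ p (q ⊕ r) n ⟨
  coeff (p ⊕ (q ⊕ r)) n                      ∎
  where open ≡-Reasoning

⊕-identityʳ : ∀ p → p ⊕ [] ≈ p
⊕-identityʳ p = ≈ₚ⇒≈ λ n → trans (coeff-⊕ p [] n) (ℚ.+-identityʳ _)

neg-inverseˡ : ∀ p → negₚ p ⊕ p ≈ []
neg-inverseˡ p = ≈ₚ⇒≈ λ n →
  trans (coeff-⊕ (negₚ p) p n) (trans (cong (_+ℚ coeff p n) (coeff-neg p n)) (ℚ.+-inverseˡ (coeff p n)))

neg-inverseʳ : ∀ p → p ⊕ negₚ p ≈ []
neg-inverseʳ p = ≈-trans (⊕-comm p (negₚ p)) (neg-inverseˡ p)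

·-distrib-⊕ : ∀ a p q → a · (p ⊕ q) ≈ a · p ⊕ a · q
·-distrib-⊕ a p q = ≈ₚ⇒≈ λ n → begin
  coeff (a · (p ⊕ q)) n                  ≡⟨ coeff-· a (p ⊕ q) n ⟩
  a *ℚ coeff (p ⊕ q) n                   ≡⟨ cong (a *ℚ_) (coeff-⊕ p q n) ⟩
  a *ℚ (coeff p n +ℚ coeff q n)          ≡⟨ ℚ.*-distribˡ-+ a (coeff p n) (coeff q n) ⟩
  a *ℚ coeff p n +ℚ a *ℚ coeff q n       ≡⟨ cong₂ _+ℚ_ (coeff-· a p n) (coeff-· a q n) ⟨
  coeff (a · p) n +ℚ coeff (a · q) n     ≡⟨ coeff-⊕ (a · p) (a · q) n ⟨
  coeff (a · p ⊕ a · q) n                ∎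
  where open ≡-Reasoning

·-assoc : ∀ a b p → (a *ℚ b) · p ≈ a · b · p
·-assoc a b p = ≈ₚ⇒≈ λ n → begin
  coeff ((a *ℚ b) · p) n     ≡⟨ coeff-· (a *ℚ b) p n ⟩
  a *ℚ b *ℚ coeff p n        ≡⟨ ℚ.*-assoc a b (coeff p n) ⟩
  a *ℚ (b *ℚ coeff p n)      ≡⟨ cong (a *ℚ_) (coeff-· b p n) ⟨
  a *ℚ coeff (b · p) n       ≡⟨ coeff-· a (b · p) n ⟨
  coeff (a · b · p) n        ∎
  where open ≡-Reasoning

·-identityˡ : ∀ p → 1ℚ · p ≈ p
·-identityˡ p = ≈ₚ⇒≈ λ n → trans (coeff-· 1ℚ p n) (ℚ.*-identityˡ (coeff p n))

·-zeroˡ : ∀ p → 0ℚ · p ≈ []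
·-zeroˡ p = ≈ₚ⇒≈ λ n → trans (coeff-· 0ℚ p n) (ℚ.*-zeroˡ (coeff p n))

shift-⊕ : ∀ p q → shift (p ⊕ q) ≈ shift p ⊕ shift q
shift-⊕ p q = ∷-cong (sym (ℚ.+-identityʳ 0ℚ)) ≈-refl

shift-· : ∀ a p → shift (a · p) ≈ a · shift p
shift-· a p = ∷-cong (sym (ℚ.*-zeroʳ a)) ≈-refl

⊕-commutativeSemigroup : CommutativeSemigroup _ _
⊕-commutativeSemigroup = record
  { _≈_ = _≈_
  ; _∙_ = _⊕_
  ; isCommutativeSemigroup = record
    { isSemigroup = record
      { isMagma = record { isEquivalence = Setoid.isEquivalence ≈-setoid ; ∙-cong = ⊕-cong }
      ; assoc   = ⊕-assoc
      }
    ; comm = ⊕-comm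
    }
  }

open Algebra.Properties.CommutativeSemigroup ⊕-commutativeSemigroup
  using () renaming (interchange to ⊕-interchange; x∙yz≈y∙xz to ⊕-leftComm)

module ≈-Reasoning = Relation.Binary.Reasoning.Setoid ≈-setoid

⊛-zeroʳ : ∀ p → p ⊛ [] ≈ []
⊛-zeroʳ []      = ≈-refl
⊛-zeroʳ (a ∷ p) = ≈ₚ⇒≈ λ { zero → refl ; (suc n) → ≈⇒≈ₚ (⊛-zeroʳ p) n }

⊛-congʳ : ∀ p {q q′} → q ≈ q′ → p ⊛ q ≈ p ⊛ q′
⊛-congʳ []      e = ≈-refl
⊛-congʳ (a ∷ p) e = ⊕-cong (·-congʳ a e) (∷-cong refl (⊛-congʳ p e))

⊛-consʳ : ∀ p b q → p ⊛ (b ∷ q) ≈ b · p ⊕ shift (p ⊛ q)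
⊛-consʳ []      b q = ≈ₚ⇒≈ λ { zero → refl ; (suc n) → refl }
⊛-consʳ (a ∷ p) b q = ∷-cong (cong (_+ℚ 0ℚ) (ℚ.*-comm a b)) (begin
  a · q ⊕ p ⊛ (b ∷ q)                 ≈⟨ ⊕-cong ≈-refl (⊛-consʳ p b q) ⟩
  a · q ⊕ (b · p ⊕ shift (p ⊛ q))     ≈⟨ ⊕-leftComm (a · q) (b · p) (shift (p ⊛ q)) ⟩
  b · p ⊕ (a · q ⊕ shift (p ⊛ q))     ∎)
  where open ≈-Reasoning

⊛-comm : ∀ p q → p ⊛ q ≈ q ⊛ p
⊛-comm []      q = ≈-sym (⊛-zeroʳ q)
⊛-comm (a ∷ p) q = ≈-trans (⊕-cong ≈-refl (∷-cong refl (⊛-comm p q))) (≈-sym (⊛-consʳ q a p))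

⊛-congˡ : ∀ {p p′} q → p ≈ p′ → p ⊛ q ≈ p′ ⊛ q
⊛-congˡ {p} {p′} q e = ≈-trans (⊛-comm p q) (≈-trans (⊛-congʳ q e) (⊛-comm q p′))

⊛-cong : ∀ {p p′ q q′} → p ≈ p′ → q ≈ q′ → p ⊛ q ≈ p′ ⊛ q′
⊛-cong {p} {q′ = q′} e e′ = ≈-trans (⊛-congʳ p e′) (⊛-congˡ q′ e)

⊛-distribˡ : ∀ p q r → p ⊛ (q ⊕ r) ≈ p ⊛ q ⊕ p ⊛ r
⊛-distribˡ []      q r = ≈-refl
⊛-distribˡ (a ∷ p) q r = begin
  a · (q ⊕ r) ⊕ shift (p ⊛ (q ⊕ r))                     ≈⟨ ⊕-cong (·-distrib-⊕ a q r) (∷-cong refl (⊛-distribˡ p q r)) ⟩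
  (a · q ⊕ a · r) ⊕ shift (p ⊛ q ⊕ p ⊛ r)               ≈⟨ ⊕-cong ≈-refl (shift-⊕ (p ⊛ q) (p ⊛ r)) ⟩
  (a · q ⊕ a · r) ⊕ (shift (p ⊛ q) ⊕ shift (p ⊛ r))     ≈⟨ ⊕-interchange (a · q) (a · r) (shift (p ⊛ q)) (shift (p ⊛ r)) ⟩
  (a · q ⊕ shift (p ⊛ q)) ⊕ (a · r ⊕ shift (p ⊛ r))     ∎
  where open ≈-Reasoning

⊛-distribʳ : ∀ p q r → (q ⊕ r) ⊛ p ≈ q ⊛ p ⊕ r ⊛ p
⊛-distribʳ p q r = ≈-trans (⊛-comm (q ⊕ r) p) (≈-trans (⊛-distribˡ p q r) (⊕-cong (⊛-comm p q) (⊛-comm p r)))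

·-⊛ : ∀ a q r → (a · q) ⊛ r ≈ a · (q ⊛ r)
·-⊛ a []      r = ≈-refl
·-⊛ a (b ∷ q) r = begin
  (a *ℚ b) · r ⊕ shift ((a · q) ⊛ r)    ≈⟨ ⊕-cong (·-assoc a b r) (∷-cong refl (·-⊛ a q r)) ⟩
  a · b · r ⊕ shift (a · (q ⊛ r))       ≈⟨ ⊕-cong ≈-refl (shift-· a (q ⊛ r)) ⟩
  a · b · r ⊕ a · shift (q ⊛ r)         ≈⟨ ·-distrib-⊕ a (b · r) (shift (q ⊛ r)) ⟨
  a · (b · r ⊕ shift (q ⊛ r))           ∎
  where open ≈-Reasoning

shift-⊛ : ∀ p q → shift p ⊛ q ≈ shift (p ⊛ q)
shift-⊛ p q = ⊕-cong (·-zeroˡ q) ≈-refl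

⊛-assoc : ∀ p q r → (p ⊛ q) ⊛ r ≈ p ⊛ (q ⊛ r)
⊛-assoc []      q r = ≈-refl
⊛-assoc (a ∷ p) q r = begin
  (a · q ⊕ shift (p ⊛ q)) ⊛ r           ≈⟨ ⊛-distribʳ r (a · q) (shift (p ⊛ q)) ⟩
  (a · q) ⊛ r ⊕ shift (p ⊛ q) ⊛ r       ≈⟨ ⊕-cong (·-⊛ a q r) (shift-⊛ (p ⊛ q) r) ⟩
  a · (q ⊛ r) ⊕ shift ((p ⊛ q) ⊛ r)     ≈⟨ ⊕-cong ≈-refl (∷-cong refl (⊛-assoc p q r)) ⟩
  a · (q ⊛ r) ⊕ shift (p ⊛ (q ⊛ r))     ∎
  where open ≈-Reasoning

⊛-identityˡ : ∀ p → oneₚ ⊛ p ≈ p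
⊛-identityˡ p = ≈-trans (⊕-cong (·-identityˡ p) (⊛-zeroʳ (shift []))) (⊕-identityʳ p)

⊛-identityʳ : ∀ p → p ⊛ oneₚ ≈ p
⊛-identityʳ p = ≈-trans (⊛-comm p oneₚ) (⊛-identityˡ p)

≈1∧≈1⇒⊛≈1 : ∀ {p q r} → p ≈ q ⊛ r → q ≈ oneₚ → r ≈ oneₚ → p ≈ oneₚ
≈1∧≈1⇒⊛≈1 p≈qr q≈1 r≈1 = ≈-trans p≈qr (≈-trans (⊛-cong q≈1 r≈1) (⊛-identityˡ oneₚ))

Poly-commutativeRing : CommutativeRing _ _
Poly-commutativeRing = record
  { Carrier = Poly
  ; _≈_ = _≈_
  ; _+_ = _⊕_
  ; _*_ = _⊛_
  ; -_  = negₚ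
  ; 0#  = []
  ; 1#  = oneₚ
  ; isCommutativeRing = record
    { isRing = record
      { +-isAbelianGroup = record
        { isGroup = record
          { isMonoid = record
            { isSemigroup = CommutativeSemigroup.isSemigroup ⊕-commutativeSemigroup
            ; identity    = (λ p → ≈-refl) , ⊕-identityʳ
            }
          ; inverse = neg-inverseˡ , neg-inverseʳ
          ; ⁻¹-cong = neg-cong
          }
        ; comm = ⊕-comm
        }
      ; *-cong     = ⊛-cong
      ; *-assoc    = ⊛-assoc
      ; *-identity = ⊛-identityˡ , ⊛-identityʳ
      ; distrib    = ⊛-distribˡ , ⊛-distribʳ
      }
    ; *-comm = ⊛-comm
    }
  }

module ⊛-Solver where
  open import Algebra.Solver.Ring.AlmostCommutativeRing
    using (fromCommutativeRing; _-Raw-AlmostCommutative⟶_)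

  constant-morphism : +-*-rawRing -Raw-AlmostCommutative⟶ fromCommutativeRing Poly-commutativeRing
  constant-morphism = record
    { ⟦_⟧    = λ c → c ∷ []
    ; +-homo = λ _ _ → ≈-refl
    ; *-homo = λ a b → ∷-cong (sym (ℚ.+-identityʳ (a *ℚ b))) ≈-refl
    ; -‿homo = λ _ → ≈-refl
    ; 0-homo = ≈ₚ⇒≈ λ { zero → refl ; (suc n) → refl }
    ; 1-homo = ≈-refl
    }

  constant-≟ : ∀ a b → Maybe (a ∷ [] ≈ b ∷ [])
  constant-≟ a b with a ℚ.≟ b
  ... | yes refl = just ≈-refl
  ... | no  _    = nothing

  open import Algebra.Solver.Ring +-*-rawRing (fromCommutativeRing Poly-commutativeRing)
    constant-morphism constant-≟ public

-- Leading terms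

DegreeAtMost : Poly → ℕ → Set
DegreeAtMost p D = ∀ n → D < n → coeff p n ≡ 0ℚ

record LeadingTerm (p : Poly) (D : ℕ) (c : ℚ) : Set where
  constructor mkLeadingTerm
  field
    coeff≡  : coeff p D ≡ c
    c≢0     : c ≢ 0ℚ
    degree≤ : DegreeAtMost p D
open LeadingTerm

coeff-∷-⊛ : ∀ a p q n → coeff ((a ∷ p) ⊛ q) n ≡ a *ℚ coeff q n +ℚ coeff (shift (p ⊛ q)) n
coeff-∷-⊛ a p q n = trans (coeff-⊕ (a · q) (shift (p ⊛ q)) n) (cong (_+ℚ coeff (shift (p ⊛ q)) n) (coeff-· a q n))

degreeAtMost-⊛ : ∀ p q D E → DegreeAtMost p D → DegreeAtMost q E →
  DegreeAtMost (p ⊛ q) (D + E) × coeff (p ⊛ q) (D + E) ≡ coeff p D *ℚ coeff q E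
degreeAtMost-⊛ []      q D E _ _ = (λ _ _ → refl) , sym (ℚ.*-zeroˡ (coeff q E))
degreeAtMost-⊛ (a ∷ p) q zero E p≤0 q≤E = (λ n E<n → trans (coeff≡a·q n) (trans (cong (a *ℚ_) (q≤E n E<n)) (ℚ.*-zeroʳ a))) , coeff≡a·q E
  where
  p⊛q≈0 : shift (p ⊛ q) ≈ []
  p⊛q≈0 = ≈ₚ⇒≈ λ { zero → refl ; (suc n) → ≈⇒≈ₚ (⊛-congˡ {p} {[]} q (≈ₚ⇒≈ λ k → p≤0 (suc k) (s≤s z≤n))) n }
  coeff≡a·q : ∀ n → coeff ((a ∷ p) ⊛ q) n ≡ a *ℚ coeff q n
  coeff≡a·q n = trans (coeff-∷-⊛ a p q n) (trans (cong (a *ℚ coeff q n +ℚ_) (≈⇒≈ₚ p⊛q≈0 n)) (ℚ.+-identityʳ _))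
degreeAtMost-⊛ (a ∷ p) q (suc D) E p≤1+D q≤E = above , top
  where
  ih = degreeAtMost-⊛ p q D E (λ n D<n → p≤1+D (suc n) (s≤s D<n)) q≤E
  a·q-vanishes : ∀ n → E < n → a *ℚ coeff q n ≡ 0ℚ
  a·q-vanishes n E<n = trans (cong (a *ℚ_) (q≤E n E<n)) (ℚ.*-zeroʳ a)
  E<1+D+E : E < suc (D + E)
  E<1+D+E = s≤s (ℕ.m≤n+m E D)
  above : DegreeAtMost ((a ∷ p) ⊛ q) (suc D + E)
  above (suc n) (s≤s D+E<n) = trans (coeff-∷-⊛ a p q (suc n))
    (trans (cong₂ _+ℚ_ (a·q-vanishes (suc n) (ℕ.<-trans E<1+D+E (s≤s D+E<n))) (proj₁ ih n D+E<n)) (ℚ.+-identityˡ 0ℚ))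
  top : coeff ((a ∷ p) ⊛ q) (suc D + E) ≡ coeff p D *ℚ coeff q E
  top = trans (coeff-∷-⊛ a p q (suc (D + E)))
    (trans (cong₂ _+ℚ_ (a·q-vanishes (suc (D + E)) E<1+D+E) (proj₂ ih)) (ℚ.+-identityˡ _))

leadingTerm-⊛ : ∀ {p q D E c e} → LeadingTerm p D c → LeadingTerm q E e → LeadingTerm (p ⊛ q) (D + E) (c *ℚ e)
leadingTerm-⊛ {p} {q} {D} {E} (mkLeadingTerm p≡c c≢0 p≤D) (mkLeadingTerm q≡e e≢0 q≤E) =
  mkLeadingTerm (trans (proj₂ pq) (cong₂ _*ℚ_ p≡c q≡e)) (x≢0∧y≢0⇒x*y≢0 c≢0 e≢0) (proj₁ pq)
  where pq = degreeAtMost-⊛ p q D E p≤D q≤E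

leadingTerm-cong : ∀ {p q D c} → p ≈ q → LeadingTerm p D c → LeadingTerm q D c
leadingTerm-cong (≈ₚ⇒≈ p≈q) (mkLeadingTerm p≡c c≢0 p≤D) =
  mkLeadingTerm (trans (sym (p≈q _)) p≡c) c≢0 (λ n D<n → trans (sym (p≈q n)) (p≤D n D<n))

leadingTerm-unique : ∀ {p D D′ c c′} → LeadingTerm p D c → LeadingTerm p D′ c′ → D ≡ D′ × c ≡ c′
leadingTerm-unique {D = D} {D′} (mkLeadingTerm p≡c c≢0 p≤D) (mkLeadingTerm p≡c′ c′≢0 p≤D′) with ℕ.<-cmp D D′
... | tri< D<D′ _ _ = ⊥-elim (c′≢0 (trans (sym p≡c′) (p≤D D′ D<D′)))
... | tri≈ _ refl _ = refl , trans (sym p≡c) p≡c′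
... | tri> _ _ D′<D = ⊥-elim (c≢0 (trans (sym p≡c) (p≤D′ D D′<D)))

leadingTerm-⊕ : ∀ {p q D c e} → LeadingTerm p D c → LeadingTerm q D e → c +ℚ e ≢ 0ℚ → LeadingTerm (p ⊕ q) D (c +ℚ e)
leadingTerm-⊕ {p} {q} {D} (mkLeadingTerm p≡c _ p≤D) (mkLeadingTerm q≡e _ q≤D) c+e≢0 =
  mkLeadingTerm (trans (coeff-⊕ p q D) (cong₂ _+ℚ_ p≡c q≡e)) c+e≢0
    (λ n D<n → trans (coeff-⊕ p q n) (trans (cong₂ _+ℚ_ (p≤D n D<n) (q≤D n D<n)) (ℚ.+-identityˡ 0ℚ)))

leadingTerm-⊕-lower : ∀ {p q D E c} → DegreeAtMost q E → E < D → LeadingTerm p D c → LeadingTerm (q ⊕ p) D c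
leadingTerm-⊕-lower {p} {q} {D} {E} {c} q≤E E<D (mkLeadingTerm p≡c c≢0 p≤D) =
  mkLeadingTerm (trans (coeff-⊕ q p D) (trans (cong₂ _+ℚ_ (q≤E D E<D) p≡c) (ℚ.+-identityˡ c))) c≢0
    (λ n D<n → trans (coeff-⊕ q p n) (trans (cong₂ _+ℚ_ (q≤E n (ℕ.<-trans E<D D<n)) (p≤D n D<n)) (ℚ.+-identityˡ 0ℚ)))

leadingTerm-neg : ∀ {p D c} → LeadingTerm p D c → LeadingTerm (negₚ p) D (- c)
leadingTerm-neg {p} {D} (mkLeadingTerm p≡c c≢0 p≤D) =
  mkLeadingTerm (trans (coeff-neg p D) (cong -_ p≡c)) (λ -c≡0 → c≢0 (ℚ.neg-injective -c≡0))
    (λ n D<n → trans (coeff-neg p n) (cong -_ (p≤D n D<n)))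

leadingTerm-one : LeadingTerm oneₚ 0 1ℚ
leadingTerm-one = mkLeadingTerm refl ℚ.1≢0 λ { (suc n) _ → refl }

leadingTerm⇒≉0 : ∀ {p D c} → LeadingTerm p D c → ¬ p ≈ []
leadingTerm⇒≉0 (mkLeadingTerm p≡c c≢0 _) (≈ₚ⇒≈ p≈0) = c≢0 (trans (sym p≡c) (p≈0 _))

leadingTerm? : ∀ p → p ≈ [] ⊎ ∃ λ D → ∃ λ c → LeadingTerm p D c
leadingTerm? [] = inj₁ ≈-refl
leadingTerm? (a ∷ p) with leadingTerm? p
... | inj₂ (D , c , mkLeadingTerm p≡c c≢0 p≤D) =
  inj₂ (suc D , c , mkLeadingTerm p≡c c≢0 λ { (suc n) (s≤s D<n) → p≤D n D<n })
... | inj₁ (≈ₚ⇒≈ p≈0) with a ℚ.≟ 0ℚ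
...   | yes a≡0 = inj₁ (≈ₚ⇒≈ λ { zero → a≡0 ; (suc n) → p≈0 n })
...   | no  a≢0 = inj₂ (0 , a , mkLeadingTerm refl a≢0 λ { (suc n) _ → p≈0 n })

≈0⇒lc≡0 : ∀ p → p ≈ [] → lc p ≡ 0ℚ
≈0⇒lc≡0 []      _ = refl
≈0⇒lc≡0 (a ∷ p) (≈ₚ⇒≈ a∷p≈0) with lc p ℚ.≟ 0ℚ
... | yes _      = a∷p≈0 0
... | no  lcp≢0 = ⊥-elim (lcp≢0 (≈0⇒lc≡0 p (≈ₚ⇒≈ λ n → a∷p≈0 (suc n))))

leadingTerm-tail : ∀ {a p D c} → LeadingTerm (a ∷ p) (suc D) c → LeadingTerm p D c
leadingTerm-tail (mkLeadingTerm p≡c c≢0 a∷p≤1+D) = mkLeadingTerm p≡c c≢0 λ n D<n → a∷p≤1+D (suc n) (s≤s D<n)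

leadingTerm⇒lc≡ : ∀ {p D c} → LeadingTerm p D c → lc p ≡ c
leadingTerm⇒lc≡ {[]} (mkLeadingTerm p≡c c≢0 _) = ⊥-elim (c≢0 (sym p≡c))
leadingTerm⇒lc≡ {a ∷ p} {zero} (mkLeadingTerm a≡c _ p≤0) with lc p ℚ.≟ 0ℚ
... | yes _      = a≡c
... | no  lcp≢0 = ⊥-elim (lcp≢0 (≈0⇒lc≡0 p (≈ₚ⇒≈ λ n → p≤0 (suc n) (s≤s z≤n))))
leadingTerm⇒lc≡ {a ∷ p} {suc D} lt with lc p ℚ.≟ 0ℚ | leadingTerm⇒lc≡ {p} (leadingTerm-tail lt)
... | yes lcp≡0 | lcp≡c = ⊥-elim (c≢0 lt (trans (sym lcp≡c) lcp≡0))
... | no  _     | lcp≡c = lcp≡c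

square≈1⇒leadingTerm : ∀ {q} → q ⊛ q ≈ oneₚ → ∃ λ c → LeadingTerm q 0 c × (c ≡ 1ℚ ⊎ c ≡ - 1ℚ)
square≈1⇒leadingTerm {q} q²≈1 with leadingTerm? q
... | inj₁ q≈0 = ⊥-elim (leadingTerm⇒≉0 (leadingTerm-cong (≈-sym q²≈1) leadingTerm-one) (⊛-congˡ {q} {[]} q q≈0))
... | inj₂ (D , c , q-lt) =
  let D+D≡0 , c²≡1 = leadingTerm-unique (leadingTerm-⊛ q-lt q-lt) (leadingTerm-cong (≈-sym q²≈1) leadingTerm-one)
  in  c , subst (λ D → LeadingTerm q D c) (x+x≡y+y⇒x≡y D 0 D+D≡0) q-lt , x*x≡y*y⇒x≡y∨x≡-y c 1ℚ c²≡1

-- Solutions of the Pell equation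

module PellEquation (h : ℕ) (d : Poly) (d-lt : LeadingTerm d (suc h + suc h) 1ℚ) where

  m : ℕ
  m = suc h

  norm : Poly → Poly → Poly
  norm f g = f ⊛ f ⊖ d ⊛ g ⊛ g

  -- (f + g√d)(f′ + g′√d) and (f + g√d)(f′ − g′√d), componentwise
  mulFst mulSnd divFst divSnd : Poly → Poly → Poly → Poly → Poly
  mulFst f g f′ g′ = f ⊛ f′ ⊕ d ⊛ g ⊛ g′
  mulSnd f g f′ g′ = f ⊛ g′ ⊕ g ⊛ f′
  divFst f g f′ g′ = f ⊛ f′ ⊖ d ⊛ g ⊛ g′
  divSnd f g f′ g′ = g ⊛ f′ ⊖ f ⊛ g′

  open ⊛-Solver using (solve; _:+_; _:*_; _:-_; :-_; _:=_)

  norm-mul : ∀ f g f′ g′ → norm (mulFst f g f′ g′) (mulSnd f g f′ g′) ≈ norm f g ⊛ norm f′ g′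
  norm-mul = solve 5 (λ d f g f′ g′ →
      (f :* f′ :+ d :* g :* g′) :* (f :* f′ :+ d :* g :* g′) :- d :* (f :* g′ :+ g :* f′) :* (f :* g′ :+ g :* f′)
    := (f :* f :- d :* g :* g) :* (f′ :* f′ :- d :* g′ :* g′)) ≈-refl d

  norm-div : ∀ f g f′ g′ → norm (divFst f g f′ g′) (divSnd f g f′ g′) ≈ norm f g ⊛ norm f′ g′
  norm-div = solve 5 (λ d f g f′ g′ →
      (f :* f′ :- d :* g :* g′) :* (f :* f′ :- d :* g :* g′) :- d :* (g :* f′ :- f :* g′) :* (g :* f′ :- f :* g′)
    := (f :* f :- d :* g :* g) :* (f′ :* f′ :- d :* g′ :* g′)) ≈-refl d

  mulFst-div : ∀ f g f′ g′ → mulFst (divFst f g f′ g′) (divSnd f g f′ g′) f′ g′ ≈ f ⊛ norm f′ g′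
  mulFst-div = solve 5 (λ d f g f′ g′ →
      (f :* f′ :- d :* g :* g′) :* f′ :+ d :* (g :* f′ :- f :* g′) :* g′
    := f :* (f′ :* f′ :- d :* g′ :* g′)) ≈-refl d

  mulFst-div-conj : ∀ f g f′ g′ → mulFst (divFst f g f′ g′) (negₚ (divSnd f g f′ g′)) f g ≈ f′ ⊛ norm f g
  mulFst-div-conj = solve 5 (λ d f g f′ g′ →
      (f :* f′ :- d :* g :* g′) :* f :+ d :* (:- (g :* f′ :- f :* g′)) :* g
    := f′ :* (f :* f :- d :* g :* g)) ≈-refl d

  norm-neg : ∀ f g → norm f (negₚ g) ≈ norm f g
  norm-neg = solve 3 (λ d f g → f :* f :- d :* (:- g) :* (:- g) := f :* f :- d :* g :* g) ≈-refl d

  square≈norm+dg² : ∀ f g → f ⊛ f ≈ norm f g ⊕ d ⊛ g ⊛ g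
  square≈norm+dg² = solve 3 (λ d f g → f :* f := (f :* f :- d :* g :* g) :+ d :* g :* g) ≈-refl d

  record Solution (f g : Poly) (K : ℕ) (a : ℚ) : Set where
    constructor mkSolution
    field
      norm≈1 : norm f g ≈ oneₚ
      f-lt   : LeadingTerm f (m + K) a
      g-lt   : LeadingTerm g K a
  open Solution public

  square-leadingTerm : ∀ {f g E e} → norm f g ≈ oneₚ → LeadingTerm g E e → LeadingTerm (f ⊛ f) ((m + E) + (m + E)) (e *ℚ e)
  square-leadingTerm {f} {g} {E} {e} norm≈1 g-lt =
    leadingTerm-cong (≈-sym f²≈1+dg²) (leadingTerm-⊕-lower (degree≤ leadingTerm-one) (s≤s z≤n) dg²-lt)
    where
    f²≈1+dg² : f ⊛ f ≈ oneₚ ⊕ d ⊛ g ⊛ g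
    f²≈1+dg² = ≈-trans (square≈norm+dg² f g) (⊕-cong norm≈1 ≈-refl)
    degree-arith : ∀ m E → m + m + E + E ≡ (m + E) + (m + E)
    degree-arith = solve-∀
    dg²-lt : LeadingTerm (d ⊛ g ⊛ g) ((m + E) + (m + E)) (e *ℚ e)
    dg²-lt = subst₂ (LeadingTerm (d ⊛ g ⊛ g)) (degree-arith m E) (cong (_*ℚ e) (ℚ.*-identityˡ e))
      (leadingTerm-⊛ (leadingTerm-⊛ d-lt g-lt) g-lt)

  solution-leadingTerms : ∀ {f g} → norm f g ≈ oneₚ → ¬ g ≈ [] →
    ∃ λ K → ∃ λ a → ∃ λ e → LeadingTerm f (m + K) a × LeadingTerm g K e × (a ≡ e ⊎ a ≡ - e)
  solution-leadingTerms {f} {g} norm≈1 g≉0 with leadingTerm? g | leadingTerm? f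
  ... | inj₁ g≈0 | _ = ⊥-elim (g≉0 g≈0)
  ... | inj₂ (E , e , g-lt) | inj₁ f≈0 =
    ⊥-elim (leadingTerm⇒≉0 (square-leadingTerm {f} norm≈1 g-lt) (⊛-congˡ {f} {[]} f f≈0))
  ... | inj₂ (E , e , g-lt) | inj₂ (D , c , f-lt) =
    let D+D≡2[m+E] , c²≡e² = leadingTerm-unique (leadingTerm-⊛ f-lt f-lt) (square-leadingTerm {f} norm≈1 g-lt)
    in  E , c , e , subst (λ D → LeadingTerm f D c) (x+x≡y+y⇒x≡y D (m + E) D+D≡2[m+E]) f-lt , g-lt ,
        x*x≡y*y⇒x≡y∨x≡-y c e c²≡e²

  normalise : ∀ {f g K a e} → norm f g ≈ oneₚ → LeadingTerm f (m + K) a → LeadingTerm g K e → a ≡ e ⊎ a ≡ - e →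
    Solution f g K a ⊎ Solution f (negₚ g) K a
  normalise         norm≈1 f-lt g-lt (inj₁ refl) = inj₁ (mkSolution norm≈1 f-lt g-lt)
  normalise {f} {g} norm≈1 f-lt g-lt (inj₂ refl) = inj₂ (mkSolution (≈-trans (norm-neg f g) norm≈1) f-lt (leadingTerm-neg g-lt))

  *-solution : ∀ {f g K a f′ g′ K′ a′} → Solution f g K a → Solution f′ g′ K′ a′ →
    Solution (mulFst f g f′ g′) (mulSnd f g f′ g′) (m + (K + K′)) (a *ℚ a′ +ℚ a *ℚ a′)
  *-solution {f} {g} {K} {a} {f′} {g′} {K′} {a′} (mkSolution n≈1 f-lt g-lt) (mkSolution n′≈1 f′-lt g′-lt) =
    mkSolution (≈1∧≈1⇒⊛≈1 (norm-mul f g f′ g′) n≈1 n′≈1)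
      (leadingTerm-⊕ (subst₂ (LeadingTerm _) (arith₁ m K K′) refl (leadingTerm-⊛ f-lt f′-lt))
                     (subst₂ (LeadingTerm _) (arith₂ m K K′) 1aa′≡aa′ (leadingTerm-⊛ (leadingTerm-⊛ d-lt g-lt) g′-lt))
                     2aa′≢0)
      (leadingTerm-⊕ (subst₂ (LeadingTerm _) (arith₃ m K K′) refl (leadingTerm-⊛ f-lt g′-lt))
                     (subst₂ (LeadingTerm _) (arith₄ m K K′) refl (leadingTerm-⊛ g-lt f′-lt))
                     2aa′≢0)
    where
    arith₁ : ∀ m K K′ → (m + K) + (m + K′) ≡ m + (m + (K + K′))
    arith₁ = solve-∀
    arith₂ : ∀ m K K′ → m + m + K + K′ ≡ m + (m + (K + K′))
    arith₂ = solve-∀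
    arith₃ : ∀ m K K′ → (m + K) + K′ ≡ m + (K + K′)
    arith₃ = solve-∀
    arith₄ : ∀ m K K′ → K + (m + K′) ≡ m + (K + K′)
    arith₄ = solve-∀
    1aa′≡aa′ : 1ℚ *ℚ a *ℚ a′ ≡ a *ℚ a′
    1aa′≡aa′ = cong (_*ℚ a′) (ℚ.*-identityˡ a)
    2aa′≢0 : a *ℚ a′ +ℚ a *ℚ a′ ≢ 0ℚ
    2aa′≢0 = x≢0⇒x+x≢0 (x≢0∧y≢0⇒x*y≢0 (c≢0 f-lt) (c≢0 f′-lt))

  ^-solution : ∀ {f g K a} → Solution f g K a → ∀ j → ∃ λ F → ∃ λ G → ∃ λ K′ → ∃ λ b →
    Solution F G K′ b × m + K′ ≡ suc j * (m + K) × 2ℚ *ℚ b ≡ (2ℚ *ℚ a) ^ suc j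
  ^-solution {f} {g} {K} {a} s zero = f , g , K , a , s , sym (ℕ.+-identityʳ (m + K)) , sym (ℚ.*-identityʳ (2ℚ *ℚ a))
  ^-solution {K = K} {a} s (suc j) with ^-solution s j
  ... | _ , _ , K′ , b , t , m+K′≡[1+j][m+K] , 2b≡[2a]ʲ⁺¹ =
    _ , _ , _ , _ , *-solution s t ,
    trans (arith m K K′) (cong (λ n → (m + K) + n) m+K′≡[1+j][m+K]) ,
    trans (2[xy+xy]≡2x*2y a b) (cong ((2ℚ *ℚ a) *ℚ_) 2b≡[2a]ʲ⁺¹)
    where
    arith : ∀ m K K′ → m + (m + (K + K′)) ≡ (m + K) + (m + K′)
    arith = solve-∀

  mulFst-degree-grows : ∀ {F G K₀ b f g K a c} → Solution F G K₀ b → Solution f g K a → ¬ LeadingTerm (mulFst F G f g) (m + K) c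
  mulFst-degree-grows {K₀ = K₀} {K = K} u s lt = ℕ.<-irrefl (proj₁ (leadingTerm-unique lt (f-lt (*-solution u s)))) m+K<deg
    where
    m+K<deg : m + K < m + (m + (K₀ + K))
    m+K<deg = ℕ.+-monoʳ-< m (s≤s (ℕ.≤-trans (ℕ.m≤n+m K K₀) (ℕ.m≤n+m (K₀ + K) h)))

  divSnd≈0⇒lc≡± : ∀ {f g K a f′ g′ a′} → Solution f g K a → Solution f′ g′ K a′ → divSnd f g f′ g′ ≈ [] → a ≡ a′ ⊎ a ≡ - a′
  divSnd≈0⇒lc≡± {f} {g} {K} {a} {f′} {g′} {a′} s s′ G≈0 =
    let c , F-lt , c≡±1 = square≈1⇒leadingTerm {F} F²≈1
        ca′≡a = proj₂ (leadingTerm-unique (leadingTerm-cong Ff′≈f (leadingTerm-⊛ F-lt (f-lt s′))) (f-lt s))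
    in  Sum.map (λ c≡1  → trans (sym ca′≡a) (trans (cong (_*ℚ a′) c≡1) (ℚ.*-identityˡ a′)))
                (λ c≡-1 → trans (sym ca′≡a) (trans (cong (_*ℚ a′) c≡-1) (-1*x≈-x a′))) c≡±1
    where
    F = divFst f g f′ g′
    G = divSnd f g f′ g′
    dGq≈0 : ∀ q → d ⊛ G ⊛ q ≈ []
    dGq≈0 q = ⊛-congˡ q (≈-trans (⊛-congʳ d G≈0) (⊛-zeroʳ d))
    F²≈1 : F ⊛ F ≈ oneₚ
    F²≈1 = begin
      F ⊛ F                    ≈⟨ square≈norm+dg² F G ⟩
      norm F G ⊕ d ⊛ G ⊛ G     ≈⟨ ⊕-cong (≈1∧≈1⇒⊛≈1 (norm-div f g f′ g′) (norm≈1 s) (norm≈1 s′)) (dGq≈0 G) ⟩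
      oneₚ ⊕ []                ≈⟨ ⊕-identityʳ oneₚ ⟩
      oneₚ                     ∎
      where open ≈-Reasoning
    Ff′≈f : F ⊛ f′ ≈ f
    Ff′≈f = begin
      F ⊛ f′                   ≈⟨ ⊕-identityʳ (F ⊛ f′) ⟨
      F ⊛ f′ ⊕ []              ≈⟨ ⊕-cong ≈-refl (dGq≈0 g′) ⟨
      mulFst F G f′ g′         ≈⟨ mulFst-div f g f′ g′ ⟩
      f ⊛ norm f′ g′           ≈⟨ ⊛-congʳ f (norm≈1 s′) ⟩
      f ⊛ oneₚ                 ≈⟨ ⊛-identityʳ f ⟩
      f                        ∎
      where open ≈-Reasoning

  same-degree⇒lc≡± : ∀ {f g K a f′ g′ a′} → Solution f g K a → Solution f′ g′ K a′ → a ≡ a′ ⊎ a ≡ - a′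
  same-degree⇒lc≡± {f} {g} {K} {a} {f′} {g′} {a′} s s′ with leadingTerm? (divSnd f g f′ g′)
  ... | inj₁ G≈0            = divSnd≈0⇒lc≡± s s′ G≈0
  ... | inj₂ (_ , _ , G-lt) =
    let K₀ , b , e , F-lt , G-lt′ , b≡±e = solution-leadingTerms {F} FG-norm≈1 (leadingTerm⇒≉0 G-lt)
    in  ⊥-elim (Sum.[ (λ u → mulFst-degree-grows u s′ (leadingTerm-cong (≈-sym F∘s′≈f) (f-lt s)))
                    , (λ u → mulFst-degree-grows u s (leadingTerm-cong (≈-sym F∘s≈f′) (f-lt s′)))
                    ]′ (normalise FG-norm≈1 F-lt G-lt′ b≡±e))
    where
    F = divFst f g f′ g′
    G = divSnd f g f′ g′
    FG-norm≈1 : norm F G ≈ oneₚ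
    FG-norm≈1 = ≈1∧≈1⇒⊛≈1 (norm-div f g f′ g′) (norm≈1 s) (norm≈1 s′)
    F∘s′≈f : mulFst F G f′ g′ ≈ f
    F∘s′≈f = ≈-trans (mulFst-div f g f′ g′) (≈-trans (⊛-congʳ f (norm≈1 s′)) (⊛-identityʳ f))
    F∘s≈f′ : mulFst F (negₚ G) f g ≈ f′
    F∘s≈f′ = ≈-trans (mulFst-div-conj f g f′ g′) (≈-trans (⊛-congʳ f′ (norm≈1 s)) (⊛-identityʳ f′))

  lc-IsIntegerℚ : ∀ {f g K a f₀ g₀ K₀ k} → Solution f g K a → Solution f₀ g₀ K₀ (fromℤ k) → IsIntegerℚ a
  lc-IsIntegerℚ {K = K} {a} {K₀ = K₀} {k} s s₀ =
    let _  , _  , K₁ , b₁ , t₁ , deg₁ , 2b₁≡[2a]ⁱ = ^-solution s (h + K₀)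
        F₂ , G₂ , K₂ , b₂ , t₂ , deg₂ , 2b₂≡[2k]ʲ = ^-solution s₀ (h + K)
        K₂≡K₁ = ℕ.+-cancelˡ-≡ m K₂ K₁ (trans deg₂ (trans (ℕ.*-comm (m + K) (m + K₀)) (sym deg₁)))
        b₁≡±b₂ = same-degree⇒lc≡± t₁ (subst (λ K → Solution F₂ G₂ K b₂) K₂≡K₁ t₂)
    in  [2a]ⁱ≡±[2k]ʲ⇒IsIntegerℚ a k (h + K₀) (h + K) (Sum.map
          (λ b₁≡b₂  → trans (sym 2b₁≡[2a]ⁱ) (trans (cong (2ℚ *ℚ_) b₁≡b₂) 2b₂≡[2k]ʲ))
          (λ b₁≡-b₂ → trans (sym 2b₁≡[2a]ⁱ) (trans (cong (2ℚ *ℚ_) b₁≡-b₂)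
                        (trans (sym (ℚ.neg-distribʳ-* 2ℚ b₂)) (cong -_ 2b₂≡[2k]ʲ))))
          b₁≡±b₂)

  pellSolution⇒solution : ∀ {f g} → norm f g ≈ oneₚ → ¬ g ≈ [] →
    ∃ λ G → ∃ λ K → ∃ λ a → Solution f G K a × (lc g ≡ a ⊎ lc g ≡ - a)
  pellSolution⇒solution {f} {g} norm≈1 g≉0 with solution-leadingTerms norm≈1 g≉0
  ... | K , a , .a , f-lt , g-lt , inj₁ refl =
    g , K , a , mkSolution norm≈1 f-lt g-lt , inj₁ (leadingTerm⇒lc≡ g-lt)
  ... | K , .(- e) , e , f-lt , g-lt , inj₂ refl =
    negₚ g , K , - e , mkSolution (≈-trans (norm-neg f g) norm≈1) f-lt (leadingTerm-neg g-lt) ,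
    inj₂ (trans (leadingTerm⇒lc≡ g-lt) (sym (⁻¹-involutive e)))

monicQuartic⇒leadingTerm : ∀ {d} → MonicQuartic d → LeadingTerm d 4 1ℚ
monicQuartic⇒leadingTerm (d₄≡1 , d≤4) =
  mkLeadingTerm d₄≡1 ℚ.1≢0 λ { (suc (suc (suc (suc (suc k))))) (s≤s (s≤s (s≤s (s≤s (s≤s _))))) → d≤4 k }

lemma5p2 : (d : Poly) → IntPoly d → MonicQuartic d → SquareFreeℤx d → Pellian d
    → (∃ λ f₀ → ∃ λ g₀ → PellSolution d f₀ g₀ × IsIntegerℚ (lc f₀))
    → ∀ f g → PellSolution d f g → IsIntegerℚ (lc f) × IsIntegerℚ (lc g)
lemma5p2 d _ monic _ _ (f₀ , g₀ , (g₀≢0 , pell₀) , k , lc-f₀≡k) f g (g≢0 , pell) =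
  let _ , _ , _ , s₀ , _        = pellSolution⇒solution {f₀} (≈ₚ⇒≈ pell₀) (λ g₀≈0 → g₀≢0 (≈⇒≈ₚ g₀≈0))
      _ , _ , a , s  , lc-g≡±a = pellSolution⇒solution {f} (≈ₚ⇒≈ pell)  (λ g≈0  → g≢0  (≈⇒≈ₚ g≈0))
      a-integral = lc-IsIntegerℚ {k = k} s (subst (Solution _ _ _) (trans (sym (leadingTerm⇒lc≡ (f-lt s₀))) lc-f₀≡k) s₀)
  in  subst IsIntegerℚ (sym (leadingTerm⇒lc≡ (f-lt s))) a-integral ,
      Sum.[ (λ lc-g≡a → subst IsIntegerℚ (sym lc-g≡a) a-integral)
          , (λ lc-g≡-a → subst IsIntegerℚ (sym lc-g≡-a) (IsIntegerℚ-neg a-integral)) ]′ lc-g≡±a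
  where open PellEquation 1 d (monicQuartic⇒leadingTerm monic)
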